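{- Let $n$ be an odd positive integer with $s(3n)=2$. Then the binary expansion of $n$ is either $1$ or the word $(10)^\ell 11$ for some $\ell\ge0$ (that is, $\ell$ copies of the block $10$ followed by $11$).
   Context: $s(n)$ is the sum of binary digits of $n$; binary words are written from most significant to least significant bit. -}

module Defs where

open import Data.Nat using (ℕ; zero; suc; _*_; _+_)
open import Data.Nat.DivMod using (_/_; _%_)
open import Data.Bool using (Bool; true; false)
open import Data.List using (List; []; _∷_; reverse; _++_; length; filter; concat; replicate)
open import Data.Nat.ListAction using (sum)

-- least-significant-first binary digits of m, using fuel (fuel ≥ m suffices);
-- digits of 0 is the empty word
bitsLSB : ℕ → ℕ → List Bool
bitsLSB zero m = []
bitsLSB (suc f) zero = []
bitsLSB (suc f) (suc m) = (((suc m) % 2) Data.Nat.≡ᵇ 1) ∷ bitsLSB f ((suc m) / 2)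

binary : ℕ → List Bool
binary n = reverse (bitsLSB n n)

bitVal : Bool → ℕ
bitVal true = 1
bitVal false = 0

s : ℕ → ℕ
s n = sum (Data.List.map bitVal (binary n))

word : ℕ → List Bool
word ℓ = concat (replicate ℓ (true ∷ false ∷ [])) ++ (true ∷ true ∷ [])

-- Since 3n is odd and has exactly two 1-bits, 3n = 1 + 2^(i+1) for some i. As 4^k ≡ 1 (mod 3),
-- 3 divides 1 + 4^k for no k, so i is even, i = 2k, and 3n = 1 + 2·4^k. For k = 0 this is n = 1;
-- for k = ℓ + 1 it is n = ((10)^ℓ 11)₂ = ((10)^(ℓ+1))₂ + 1, because 3·((10)^m)₂ + 2 = 2·4^m.
module Submission where

open import Defs
open import Level using (Level)
open import Data.Nat using (ℕ; zero; suc; _+_; _*_; _^_; _%_; _/_; _≡ᵇ_; _≤_; _>_; s≤s)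
open import Data.Nat.Properties using (≤-refl; ≤-trans; m≤m*n; *-comm; *-cancelˡ-≡; ^-*-assoc; suc-injective; 0≢1+n)
open import Data.Nat.DivMod using ([m+kn]%n≡m%n; m*n%n≡0; m*n/n≡m; +-distrib-/-∣ʳ; %-distribˡ-+; %-distribˡ-*)
open import Data.Nat.Divisibility using (_∣_; divides-refl; m∣m*n; n∣m⇒m%n≡0)
open import Data.Nat.Tactic.RingSolver using (solve-∀)
open import Data.Nat.ListAction using (sum)
open import Data.Nat.ListAction.Properties using (sum-↭)
open import Data.Bool using (Bool; true; false)
open import Data.List using (List; []; _∷_; map; reverse; _++_; concat; replicate)
open import Data.List.Properties using (++-identityʳ; ++-assoc; reverse-++; reverse-map)
open import Data.List.Relation.Binary.Permutation.Propositional.Properties using (↭-reverse)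
open import Data.Product using (∃-syntax; _,_)
open import Data.Sum using (_⊎_; inj₁; inj₂)
open import Data.Empty using (⊥-elim)
open import Relation.Nullary using (¬_)
open import Relation.Binary.PropositionalEquality using (_≡_; refl; sym; trans; cong; cong₂; subst; module ≡-Reasoning)

open ≡-Reasoning

private
  variable
    a : Level
    A : Set a

concat-replicate-++-comm : ∀ n (xs : List A) →
  concat (replicate n xs) ++ xs ≡ xs ++ concat (replicate n xs)
concat-replicate-++-comm zero    xs = sym (++-identityʳ xs)
concat-replicate-++-comm (suc n) xs = begin
  (xs ++ concat (replicate n xs)) ++ xs  ≡⟨ ++-assoc xs _ xs ⟩
  xs ++ (concat (replicate n xs) ++ xs)  ≡⟨ cong (xs ++_) (concat-replicate-++-comm n xs) ⟩
  xs ++ (xs ++ concat (replicate n xs))  ∎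

reverse-concat-replicate : ∀ n (xs : List A) →
  reverse (concat (replicate n xs)) ≡ concat (replicate n (reverse xs))
reverse-concat-replicate zero    xs = refl
reverse-concat-replicate (suc n) xs = begin
  reverse (xs ++ concat (replicate n xs))                ≡⟨ reverse-++ xs _ ⟩
  reverse (concat (replicate n xs)) ++ reverse xs        ≡⟨ cong (_++ reverse xs) (reverse-concat-replicate n xs) ⟩
  concat (replicate n (reverse xs)) ++ reverse xs        ≡⟨ concat-replicate-++-comm n (reverse xs) ⟩
  reverse xs ++ concat (replicate n (reverse xs))        ∎

data Parity : ℕ → Set where
  even : ∀ q → Parity (q * 2)
  odd  : ∀ q → Parity (suc (q * 2))

parity : ∀ m → Parity m
parity zero = even zero
parity (suc m) with parity m
... | even q = odd q
... | odd q  = even (suc q)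

odd*odd≡odd : ∀ m n → m % 2 ≡ 1 → n % 2 ≡ 1 → m * n % 2 ≡ 1
odd*odd≡odd m n m-odd n-odd = begin
  m * n % 2                  ≡⟨ %-distribˡ-* m n 2 ⟩
  (m % 2) * (n % 2) % 2      ≡⟨ cong₂ (λ x y → x * y % 2) m-odd n-odd ⟩
  1                          ∎

bitsLSB-odd : ∀ f q → bitsLSB (suc f) (suc (q * 2)) ≡ true ∷ bitsLSB f q
bitsLSB-odd f q = cong₂ _∷_ (cong (_≡ᵇ 1) ([m+kn]%n≡m%n 1 q 2)) (cong (bitsLSB f) [1+q*2]/2≡q)
  where
  [1+q*2]/2≡q : suc (q * 2) / 2 ≡ q
  [1+q*2]/2≡q = trans (+-distrib-/-∣ʳ 1 {d = 2} (divides-refl q)) (m*n/n≡m q 2)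

bitsLSB-even : ∀ f q → bitsLSB (suc f) (suc q * 2) ≡ false ∷ bitsLSB f (suc q)
bitsLSB-even f q = cong₂ _∷_ (cong (_≡ᵇ 1) (m*n%n≡0 (suc q) 2)) (cong (bitsLSB f) (m*n/n≡m (suc q) 2))

half-odd : ∀ {q f} → suc (q * 2) ≤ suc f → q ≤ f
half-odd {q} (s≤s q*2≤f) = ≤-trans (m≤m*n q 2) q*2≤f

half-even : ∀ {q f} → suc q * 2 ≤ suc f → suc q ≤ f
half-even {q} (s≤s 1+q*2≤f) = ≤-trans (s≤s (m≤m*n q 2)) 1+q*2≤f

digitSum : ℕ → ℕ → ℕ
digitSum f m = sum (map bitVal (bitsLSB f m))

s≡digitSum : ∀ m → s m ≡ digitSum m m
s≡digitSum m = trans (cong sum (reverse-map bitVal (bitsLSB m m)))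
                     (sum-↭ (↭-reverse (map bitVal (bitsLSB m m))))

digitSum-odd : ∀ f q → digitSum (suc f) (suc (q * 2)) ≡ suc (digitSum f q)
digitSum-odd f q = cong (λ bs → sum (map bitVal bs)) (bitsLSB-odd f q)

digitSum-even : ∀ f q → digitSum (suc f) (suc q * 2) ≡ digitSum f (suc q)
digitSum-even f q = cong (λ bs → sum (map bitVal bs)) (bitsLSB-even f q)

digitSum≡0⇒≡0 : ∀ f m → m ≤ f → digitSum f m ≡ 0 → m ≡ 0
digitSum≡0⇒≡0 f m m≤f sum≡0 with parity m
digitSum≡0⇒≡0 f       _ _   _     | even zero = refl
digitSum≡0⇒≡0 (suc f) _ m≤f sum≡0 | even (suc q)
  with () ← digitSum≡0⇒≡0 f (suc q) (half-even m≤f) (trans (sym (digitSum-even f q)) sum≡0)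
digitSum≡0⇒≡0 (suc f) _ m≤f sum≡0 | odd q = ⊥-elim (0≢1+n (trans (sym sum≡0) (digitSum-odd f q)))

digitSum≡1⇒≡2^ : ∀ f m → m ≤ f → digitSum f m ≡ 1 → ∃[ j ] m ≡ 2 ^ j
digitSum≡1⇒≡2^ f m m≤f sum≡1 with parity m
digitSum≡1⇒≡2^ zero    _ _ () | even zero
digitSum≡1⇒≡2^ (suc f) _ _ () | even zero
digitSum≡1⇒≡2^ (suc f) _ m≤f sum≡1 | even (suc q)
  with j , 1+q≡2^j ← digitSum≡1⇒≡2^ f (suc q) (half-even m≤f) (trans (sym (digitSum-even f q)) sum≡1)
  = suc j , trans (cong (_* 2) 1+q≡2^j) (*-comm (2 ^ j) 2)
digitSum≡1⇒≡2^ (suc f) _ m≤f sum≡1 | odd q =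
  0 , cong (λ x → suc (x * 2)) (digitSum≡0⇒≡0 f q (half-odd m≤f) digitSum≡0)
  where
  digitSum≡0 : digitSum f q ≡ 0
  digitSum≡0 = suc-injective (trans (sym (digitSum-odd f q)) sum≡1)

odd∧s≡2⇒≡1+2^ : ∀ m → m % 2 ≡ 1 → s m ≡ 2 → ∃[ i ] m ≡ 1 + 2 ^ suc i
odd∧s≡2⇒≡1+2^ m m-odd s≡2 with parity m
... | even q = ⊥-elim (0≢1+n (trans (sym (m*n%n≡0 q 2)) m-odd))
... | odd q
  with i , q≡2^i ← digitSum≡1⇒≡2^ (q * 2) q (m≤m*n q 2)
                     (suc-injective (trans (sym (digitSum-odd (q * 2) q)) (trans (sym (s≡digitSum (suc (q * 2)))) s≡2)))
  = i , cong suc (trans (cong (_* 2) q≡2^i) (*-comm (2 ^ i) 2))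

4^k%3≡1 : ∀ k → 4 ^ k % 3 ≡ 1
4^k%3≡1 zero    = refl
4^k%3≡1 (suc k) = begin
  4 * 4 ^ k % 3              ≡⟨ %-distribˡ-* 4 (4 ^ k) 3 ⟩
  (1 * (4 ^ k % 3)) % 3      ≡⟨ cong (λ r → (1 * r) % 3) (4^k%3≡1 k) ⟩
  1                          ∎

3∤1+4^k : ∀ k → ¬ 3 ∣ 1 + 4 ^ k
3∤1+4^k k 3∣1+4^k = 0≢1+n (begin
  0                          ≡⟨ sym (n∣m⇒m%n≡0 (1 + 4 ^ k) 3 3∣1+4^k) ⟩
  (1 + 4 ^ k) % 3            ≡⟨ %-distribˡ-+ 1 (4 ^ k) 3 ⟩
  (1 + 4 ^ k % 3) % 3        ≡⟨ cong (λ r → (1 + r) % 3) (4^k%3≡1 k) ⟩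
  2                          ∎)

2^[k*2]≡4^k : ∀ k → 2 ^ (k * 2) ≡ 4 ^ k
2^[k*2]≡4^k k = trans (cong (2 ^_) (*-comm k 2)) (sym (^-*-assoc 2 2 k))

odd∧s[3n]≡2⇒3n≡1+2*4^k : ∀ n → n % 2 ≡ 1 → s (3 * n) ≡ 2 → ∃[ k ] 3 * n ≡ 1 + 2 * 4 ^ k
odd∧s[3n]≡2⇒3n≡1+2*4^k n n-odd s[3n]≡2
  with i , 3n≡1+2^[1+i] ← odd∧s≡2⇒≡1+2^ (3 * n) (odd*odd≡odd 3 n refl n-odd) s[3n]≡2
  with parity i
... | even k = k , trans 3n≡1+2^[1+i] (cong (λ x → 1 + 2 * x) (2^[k*2]≡4^k k))
... | odd k  = ⊥-elim (3∤1+4^k (suc k) (subst (3 ∣_) 3n≡1+4^[1+k] (m∣m*n n)))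
  where
  3n≡1+4^[1+k] : 3 * n ≡ 1 + 4 ^ suc k
  3n≡1+4^[1+k] = trans 3n≡1+2^[1+i] (cong (1 +_) (2^[k*2]≡4^k (suc k)))

-- repeat10 ℓ and wordValue ℓ have binary expansions (10)^ℓ and (10)^ℓ 11; repeat10 appends bits
-- on the right, the form in which bitsLSB-odd and bitsLSB-even apply.
repeat10 : ℕ → ℕ
repeat10 zero    = 0
repeat10 (suc ℓ) = suc (repeat10 ℓ * 2) * 2

wordValue : ℕ → ℕ
wordValue ℓ = suc (repeat10 (suc ℓ))

3*repeat10+2≡2*4^ℓ : ∀ ℓ → 3 * repeat10 ℓ + 2 ≡ 2 * 4 ^ ℓ
3*repeat10+2≡2*4^ℓ zero    = refl
3*repeat10+2≡2*4^ℓ (suc ℓ) = begin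
  3 * (suc (repeat10 ℓ * 2) * 2) + 2  ≡⟨ step (repeat10 ℓ) ⟩
  4 * (3 * repeat10 ℓ + 2)            ≡⟨ cong (4 *_) (3*repeat10+2≡2*4^ℓ ℓ) ⟩
  4 * (2 * 4 ^ ℓ)                     ≡⟨ swap (4 ^ ℓ) ⟩
  2 * (4 * 4 ^ ℓ)                     ∎
  where
  step : ∀ u → 3 * (suc (u * 2) * 2) + 2 ≡ 4 * (3 * u + 2)
  step = solve-∀
  swap : ∀ x → 4 * (2 * x) ≡ 2 * (4 * x)
  swap = solve-∀

3*wordValue≡1+2*4^[1+ℓ] : ∀ ℓ → 3 * wordValue ℓ ≡ 1 + 2 * 4 ^ suc ℓ
3*wordValue≡1+2*4^[1+ℓ] ℓ = begin
  3 * suc (repeat10 (suc ℓ))        ≡⟨ step (repeat10 (suc ℓ)) ⟩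
  1 + (3 * repeat10 (suc ℓ) + 2)    ≡⟨ cong (1 +_) (3*repeat10+2≡2*4^ℓ (suc ℓ)) ⟩
  1 + 2 * 4 ^ suc ℓ                 ∎
  where
  step : ∀ u → 3 * suc u ≡ 1 + (3 * u + 2)
  step = solve-∀

bitsLSB-repeat10 : ∀ ℓ {f} → repeat10 ℓ ≤ f →
  bitsLSB f (repeat10 ℓ) ≡ concat (replicate ℓ (false ∷ true ∷ []))
bitsLSB-repeat10 zero    {zero}  _ = refl
bitsLSB-repeat10 zero    {suc f} _ = refl
bitsLSB-repeat10 (suc ℓ) {suc zero} (s≤s ())
bitsLSB-repeat10 (suc ℓ) {suc (suc f)} u≤f = begin
  bitsLSB (suc (suc f)) (suc (repeat10 ℓ * 2) * 2)  ≡⟨ bitsLSB-even (suc f) (repeat10 ℓ * 2) ⟩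
  false ∷ bitsLSB (suc f) (suc (repeat10 ℓ * 2))   ≡⟨ cong (false ∷_) (bitsLSB-odd f (repeat10 ℓ)) ⟩
  false ∷ true ∷ bitsLSB f (repeat10 ℓ)            ≡⟨ cong (λ bs → false ∷ true ∷ bs)
                                                          (bitsLSB-repeat10 ℓ (half-odd (half-even u≤f))) ⟩
  false ∷ true ∷ concat (replicate ℓ (false ∷ true ∷ []))  ∎

binary-wordValue : ∀ ℓ → binary (wordValue ℓ) ≡ word ℓ
binary-wordValue ℓ = begin
  reverse (bitsLSB (wordValue ℓ) (wordValue ℓ))     ≡⟨ cong reverse bits ⟩
  reverse ((true ∷ true ∷ []) ++ lsb)               ≡⟨ reverse-++ (true ∷ true ∷ []) lsb ⟩
  reverse lsb ++ (true ∷ true ∷ [])                 ≡⟨ cong (_++ (true ∷ true ∷ [])) (reverse-concat-replicate ℓ _) ⟩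
  word ℓ                                            ∎
  where
  u : ℕ
  u = repeat10 ℓ
  lsb : List Bool
  lsb = concat (replicate ℓ (false ∷ true ∷ []))
  bits : bitsLSB (wordValue ℓ) (wordValue ℓ) ≡ true ∷ true ∷ lsb
  bits = begin
    bitsLSB _ (suc (suc (u * 2) * 2))  ≡⟨ bitsLSB-odd _ (suc (u * 2)) ⟩
    true ∷ bitsLSB _ (suc (u * 2))     ≡⟨ cong (true ∷_) (bitsLSB-odd _ u) ⟩
    true ∷ true ∷ bitsLSB _ u          ≡⟨ cong (λ bs → true ∷ true ∷ bs) (bitsLSB-repeat10 ℓ (half-odd (half-odd ≤-refl))) ⟩
    true ∷ true ∷ lsb                  ∎

lemma3 : (n : ℕ) → n > 0 → n % 2 ≡ 1 → s (3 * n) ≡ 2 →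
    binary n ≡ true ∷ [] ⊎ ∃[ ℓ ] binary n ≡ word ℓ
lemma3 n _ n-odd s[3n]≡2 with odd∧s[3n]≡2⇒3n≡1+2*4^k n n-odd s[3n]≡2
... | zero  , 3n≡3 = inj₁ (cong binary (*-cancelˡ-≡ n 1 3 3n≡3))
... | suc ℓ , 3n≡1+2*4^[1+ℓ] = inj₂ (ℓ , trans (cong binary n≡wordValue) (binary-wordValue ℓ))
  where
  n≡wordValue : n ≡ wordValue ℓ
  n≡wordValue = *-cancelˡ-≡ n (wordValue ℓ) 3 (trans 3n≡1+2*4^[1+ℓ] (sym (3*wordValue≡1+2*4^[1+ℓ] ℓ)))
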